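{- For every $t\in\mathbb{N}$ there exists $c=c(t)\in\mathbb{N}$ with the following property. Let $G$ be a $K_{t,t}$-free graph, $Z\subseteq V(G)$ with $|Z|\geq 2$, $H$ a graph, and $\eta$ an extended strip decomposition of $(G,Z)$ with pattern $H$. Then for every vertex $v\in V(G)\setminus Z$ there exists $X\subseteq V(G)\setminus\{v\}$ such that $X$ intersects every leaf path ending at $v$ and $\alpha(G[X])\leq c$.
   Context: Graphs are finite and simple; $K_{t,t}$-free means no induced subgraph isomorphic to $K_{t,t}$. A path $p_1\text{ - }\dots\text{ - }p_k$ means an induced path. Extended strip decomposition: let $G,H$ be graphs, $Z\subseteq V(G)$, $W$ the set of degree-one vertices of $H$, $T(H)$ the set of triangles of $H$. An extended strip decomposition of $(G,Z)$ with pattern $H$ is a map $\eta$ from $E(H)\cup V(H)\cup T(H)\cup\{(e,v): e\in E(H), v \text{ an end of } e\}$ to $2^{V(G)}$ such that: (1) every $v\in V(G)$ lies in $\eta(x)$ for a unique $x\in E(H)\cup V(H)\cup T(H)$; (2) $\eta(e,v)\subseteq\eta(e)$; (3) for distinct $e,f\in E(H)$, $x\in\eta(e)$, $y\in\eta(f)$: $xy\in E(G)$ iff $e,f$ share an end $v$ with $x\in\eta(e,v)$, $y\in\eta(f,v)$; (4) if $v\in V(H)$, $x\in\eta(v)$, $y\notin\eta(v)$, $xy\in E(G)$, then $y\in\eta(e,v)$ for some edge $e$ incident with $v$; (5) if $D\in T(H)$, $x\in\eta(D)$, $y\notin\eta(D)$, $xy\in E(G)$, then $y\in\eta(e,u)\cap\eta(e,v)$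 for some distinct $u,v\in D$ with $e=uv$; (6) $|Z|=|W|$ and for each $z\in Z$ there is $w\in W$ with $\eta(e,w)=\{z\}$, where $e$ is the edge of $H$ incident with $w$. A leaf path ending at $v$ is a path $p_1\text{ - }\dots\text{ - }p_k$ of $G$ with $p_1\in Z$ and $p_k=v$. -}

module Defs where

open import Data.Bool using (Bool; true; false; T)
open import Data.Nat using (ℕ; zero; suc; _≤_; _≡ᵇ_)
open import Data.Fin using (Fin; toℕ; fromℕ; _<_)
open import Data.Fin.Subset using (Subset; _∈_; _∉_; _⊆_; ∣_∣; ⁅_⁆)
open import Data.Vec using (tabulate)
open import Data.Product using (Σ; _×_; _,_)
open import Data.Sum using (_⊎_)
open import Data.Empty using (⊥)
open import Relation.Nullary using (¬_)
open import Relation.Binary.PropositionalEquality using (_≡_; _≢_)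
open import Function using (_⇔_)
open import Function.Definitions using (Injective)

record Graph (n : ℕ) : Set where
  field
    adj   : Fin n → Fin n → Bool
    sym   : ∀ x y → adj x y ≡ adj y x
    irrfl : ∀ x → adj x x ≡ false
open Graph public

Adj : ∀ {n} → Graph n → Fin n → Fin n → Set
Adj G x y = adj G x y ≡ true

degree : ∀ {n} → Graph n → Fin n → ℕ
degree G w = ∣ tabulate (adj G w) ∣

HasInducedKtt : ∀ {n} → Graph n → ℕ → Set
HasInducedKtt {n} G t =
  Σ (Fin t → Fin n) λ f → Σ (Fin t → Fin n) λ g →
    Injective _≡_ _≡_ f × Injective _≡_ _≡_ g ×
    (∀ i j → f i ≢ g j) ×
    (∀ i j → Adj G (f i) (g j)) ×
    (∀ i j → ¬ Adj G (f i) (f j)) ×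
    (∀ i j → ¬ Adj G (g i) (g j))

KttFree : ∀ {n} → Graph n → ℕ → Set
KttFree G t = ¬ HasInducedKtt G t

record Edge {m : ℕ} (H : Graph m) : Set where
  constructor edge
  field
    u v  : Fin m
    u<v  : u < v
    uv   : Adj H u v

data EndOf {m : ℕ} {H : Graph m} (e : Edge H) : Fin m → Set where
  lft : EndOf e (Edge.u e)
  rgt : EndOf e (Edge.v e)

record Triangle {m : ℕ} (H : Graph m) : Set where
  constructor triangle
  field
    a b c : Fin m
    a<b   : a < b
    b<c   : b < c
    ab    : Adj H a b
    ac    : Adj H a c
    bc    : Adj H b c

InTri : ∀ {m} {H : Graph m} → Triangle H → Fin m → Set
InTri D w = w ≡ Triangle.a D ⊎ w ≡ Triangle.b D ⊎ w ≡ Triangle.c D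

data Loc {m : ℕ} (H : Graph m) : Set where
  inE : Edge H → Loc H
  inV : Fin m → Loc H
  inT : Triangle H → Loc H

W : ∀ {m} → Graph m → Subset m
W H = tabulate (λ w → degree H w ≡ᵇ 1)

record ESD {n m : ℕ} (G : Graph n) (Z : Subset n) (H : Graph m) : Set where
  field
    η   : Loc H → Subset n
    η₂  : (e : Edge H) (w : Fin m) → EndOf e w → Subset n
    cover  : ∀ x → Σ (Loc H) λ l → x ∈ η l
    unique : ∀ l l' x → x ∈ η l → x ∈ η l' → l ≡ l'
    end⊆   : ∀ e w (p : EndOf e w) → η₂ e w p ⊆ η (inE e)
    edges  : ∀ (e f : Edge H) → e ≢ f → ∀ x y → x ∈ η (inE e) → y ∈ η (inE f) →
             Adj G x y ⇔
             (Σ (Fin m) λ w → Σ (EndOf e w) λ p → Σ (EndOf f w) λ q →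
                x ∈ η₂ e w p × y ∈ η₂ f w q)
    vertex : ∀ v x y → x ∈ η (inV v) → y ∉ η (inV v) → Adj G x y →
             Σ (Edge H) λ e → Σ (EndOf e v) λ p → y ∈ η₂ e v p
    tri    : ∀ D x y → x ∈ η (inT D) → y ∉ η (inT D) → Adj G x y →
             Σ (Edge H) λ e → InTri D (Edge.u e) × InTri D (Edge.v e) ×
               y ∈ η₂ e (Edge.u e) lft × y ∈ η₂ e (Edge.v e) rgt
    |Z|≡|W| : ∣ Z ∣ ≡ ∣ W H ∣
    leaves  : ∀ z → z ∈ Z → Σ (Fin m) λ w → degree H w ≡ 1 ×
              Σ (Edge H) λ e → Σ (EndOf e w) λ p → η₂ e w p ≡ ⁅ z ⁆

IsInducedPath : ∀ {n} (G : Graph n) {k : ℕ} → (Fin (suc k) → Fin n) → Set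
IsInducedPath G p =
  Injective _≡_ _≡_ p ×
  (∀ i j → Adj G (p i) (p j) ⇔ (toℕ i ≡ suc (toℕ j) ⊎ toℕ j ≡ suc (toℕ i)))

record LeafPath {n} (G : Graph n) (Z : Subset n) (v : Fin n) : Set where
  field
    k     : ℕ
    path  : Fin (suc k) → Fin n
    isInd : IsInducedPath G path
    start : path Data.Fin.zero ∈ Z
    stop  : path (fromℕ k) ≡ v

Independent : ∀ {n} → Graph n → Subset n → Set
Independent G S = ∀ x y → x ∈ S → y ∈ S → ¬ Adj G x y

αLe : ∀ {n} → Graph n → Subset n → ℕ → Set
αLe G X c = ∀ S → S ⊆ X → Independent G S → ∣ S ∣ ≤ c

Meets : ∀ {n} {G : Graph n} {Z : Subset n} {v : Fin n} → Subset n → LeafPath G Z v → Set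
Meets X P = Σ (Fin (suc (LeafPath.k P))) λ i → LeafPath.path P i ∈ X

-- At a vertex s of the pattern H, port classes η(e,s) and η(f,s) of distinct edges are
-- complete to each other. So in a K_{t,t}-free graph at most one port at s is large, that is
-- contains an independent set of size t + 2, and an independent set inside the small ports at
-- s lies in one of them, so it has size at most t + 1.
-- Let T₀ be the at most three vertices of H at the location of v. X consists of the vertices
-- other than v in small ports at T₀, or at the far end of the large port at a vertex of T₀;
-- hence α(X) ≤ 6(t + 1). The strips of the edges at v and of the large ports at T₀, with the
-- vertex and triangle locations they lead into, form a region that no edge of G leaves except
-- through X. A leaf z is the whole of its port class, which is therefore small; so z lies
-- outside the region, and every leaf path to v meets X.

{-# OPTIONS --safe #-}
module Submission where

open import Defs
open import Data.Nat using (ℕ; _≤_)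
open import Data.Fin using (Fin)
open import Data.Fin.Subset using (Subset; _∈_; _∉_; ∣_∣)
open import Data.Product using (Σ; _×_)

open import Axiom.UniquenessOfIdentityProofs.WithK using (uip)
open import Data.Bool using (Bool; true; false; not)
open import Data.Bool.Properties using (T-≡) renaming (_≟_ to _≟ᴮ_)
open import Data.Empty using (⊥-elim)
open import Data.Fin using (zero; suc; inject₁; fromℕ; _<_; _<?_)
open import Data.Fin.Properties using (all?; any?; <-irrelevant; <⇒≢; toℕ-inject₁; suc-injective)
  renaming (_≟_ to _≟ᶠ_)
open import Data.Fin.Subset using (_⊆_; _∪_; _∩_; ⁅_⁆; ⋃; Nonempty; outside; inside; ⊥)
open import Data.Fin.Subset.Properties
  using (_∈?_; _⊆?_; anySubset?; nonempty?; Empty-unique; ∉⊥; ∣⊥∣≡0; x∈⁅x⁆; ∣⁅x⁆∣≡1;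
         x∈p∪q⁺; x∈p∪q⁻; x∈p∩q⁺; p∩q⊆p; p∩q⊆q; p⊆q⇒∣p∣≤∣q∣)
import Data.List as List
open import Data.Nat using (zero; suc; _+_; _*_; z≤n; s≤s; _≤?_)
open import Data.Nat.Properties
  using (module ≤-Reasoning; ≤-trans; ≤-reflexive; ≮⇒≥; n≤1+n; m≤n+m; +-suc; +-monoʳ-≤; +-mono-≤)
open import Data.Product using (_,_; proj₁; proj₂)
open import Data.Sum using (_⊎_; inj₁; inj₂; fromInj₂)
open import Data.Vec using (_∷_; []; here; there; tabulate; lookup)
open import Data.Vec.Properties using (lookup∘tabulate; lookup⇒[]=; []=⇒lookup)
open import Function using (_∘_; Equivalence)
open import Function.Definitions using (Injective)
open import Relation.Nullary using (¬_; Dec; yes; no)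
open import Relation.Nullary.Decidable
  using (isYes; toWitness; fromWitness; decidable-stable; map′; ¬?; _×-dec_; _⊎-dec_; _→-dec_)
open import Relation.Binary.PropositionalEquality using (_≡_; _≢_; refl; trans; cong; cong₂; subst)
import Relation.Binary.PropositionalEquality as ≡

toSubset : ∀ {n} {Q : Fin n → Set} → (∀ x → Dec (Q x)) → Subset n
toSubset Q? = tabulate (λ x → isYes (Q? x))

∈-toSubset⁺ : ∀ {n} {Q : Fin n → Set} (Q? : ∀ x → Dec (Q x)) {x} → Q x → x ∈ toSubset Q?
∈-toSubset⁺ Q? {x} q =
  lookup⇒[]= x _ (trans (lookup∘tabulate _ x) (Equivalence.to T-≡ (fromWitness {a? = Q? x} q)))

∈-toSubset⁻ : ∀ {n} {Q : Fin n → Set} (Q? : ∀ x → Dec (Q x)) {x} → x ∈ toSubset Q? → Q x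
∈-toSubset⁻ Q? {x} x∈ =
  toWitness {a? = Q? x} (Equivalence.from T-≡ (trans (≡.sym (lookup∘tabulate _ x)) ([]=⇒lookup x∈)))

∈-⋃⁺ : ∀ {n k} (A : Fin k → Subset n) i {x} → x ∈ A i → x ∈ ⋃ (List.tabulate A)
∈-⋃⁺ A zero    x∈A = x∈p∪q⁺ (inj₁ x∈A)
∈-⋃⁺ A (suc i) x∈A = x∈p∪q⁺ (inj₂ (∈-⋃⁺ (A ∘ suc) i x∈A))

∣p∪q∣≤∣p∣+∣q∣ : ∀ {n} (p q : Subset n) → ∣ p ∪ q ∣ ≤ ∣ p ∣ + ∣ q ∣
∣p∪q∣≤∣p∣+∣q∣ []            []            = z≤n
∣p∪q∣≤∣p∣+∣q∣ (outside ∷ p) (outside ∷ q) = ∣p∪q∣≤∣p∣+∣q∣ p q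
∣p∪q∣≤∣p∣+∣q∣ (outside ∷ p) (inside ∷ q)  =
  ≤-trans (s≤s (∣p∪q∣≤∣p∣+∣q∣ p q)) (≤-reflexive (≡.sym (+-suc ∣ p ∣ ∣ q ∣)))
∣p∪q∣≤∣p∣+∣q∣ (inside ∷ p)  (outside ∷ q) = s≤s (∣p∪q∣≤∣p∣+∣q∣ p q)
∣p∪q∣≤∣p∣+∣q∣ (inside ∷ p)  (inside ∷ q)  =
  s≤s (≤-trans (∣p∪q∣≤∣p∣+∣q∣ p q) (+-monoʳ-≤ ∣ p ∣ (n≤1+n ∣ q ∣)))

≤∣p∣⇒injection : ∀ {n} k (p : Subset n) → k ≤ ∣ p ∣ →
  Σ (Fin k → Fin n) λ f → Injective _≡_ _≡_ f × (∀ i → f i ∈ p)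
≤∣p∣⇒injection zero    p             _ = (λ ()) , (λ { {()} }) , λ ()
≤∣p∣⇒injection (suc k) (outside ∷ p) k<∣p∣ with ≤∣p∣⇒injection (suc k) p k<∣p∣
... | f , f-inj , f∈p = suc ∘ f , f-inj ∘ suc-injective , there ∘ f∈p
≤∣p∣⇒injection (suc k) (inside ∷ p) (s≤s k≤∣p∣) with ≤∣p∣⇒injection k p k≤∣p∣
... | f , f-inj , f∈p = g , g-inj , g∈
  where
  g : Fin (suc k) → Fin _
  g zero    = zero
  g (suc i) = suc (f i)
  g-inj : Injective _≡_ _≡_ g
  g-inj {zero}  {zero}  _  = refl
  g-inj {suc i} {suc j} eq = cong suc (f-inj (suc-injective eq))
  g-inj {zero}  {suc j} ()
  g-inj {suc i} {zero}  ()
  g∈ : ∀ i → g i ∈ (inside ∷ p)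
  g∈ zero    = here
  g∈ (suc i) = there (f∈p i)

propagate-down : ∀ {A : Set} {k} (Q : Fin (suc k) → Set) →
  (∀ j → Q (suc j) → Q (inject₁ j) ⊎ A) → Q (fromℕ k) → Q zero ⊎ A
propagate-down {k = zero}  Q step q = inj₁ q
propagate-down {k = suc k} Q step q with propagate-down (Q ∘ suc) (step ∘ suc) q
... | inj₁ q₁ = step zero q₁
... | inj₂ a  = inj₂ a

IsInducedPath-adjacent : ∀ {n k} {G : Graph n} {p : Fin (suc k) → Fin n} → IsInducedPath G p →
  ∀ j → Adj G (p (suc j)) (p (inject₁ j))
IsInducedPath-adjacent (_ , adj⇔) j =
  Equivalence.from (adj⇔ (suc j) (inject₁ j)) (inj₁ (cong suc (≡.sym (toℕ-inject₁ j))))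

module _ {n : ℕ} {G : Graph n} where

  Independent-⊆ : ∀ {S S'} → S' ⊆ S → Independent G S → Independent G S'
  Independent-⊆ S'⊆S ind x y x∈ y∈ = ind x y (S'⊆S x∈) (S'⊆S y∈)

  independent? : ∀ S → Dec (Independent G S)
  independent? S = all? λ x → all? λ y → (x ∈? S) →-dec ((y ∈? S) →-dec ¬? (adj G x y ≟ᴮ true))

  αLe-⊆ : ∀ {A B c} → A ⊆ B → αLe G B c → αLe G A c
  αLe-⊆ A⊆B αB S S⊆A = αB S (A⊆B ∘ S⊆A)

  αLe-nonempty : ∀ {A c} → (∀ S → S ⊆ A → Independent G S → Nonempty S → ∣ S ∣ ≤ c) → αLe G A c
  αLe-nonempty bound S S⊆A ind with nonempty? S
  ... | yes ne = bound S S⊆A ind ne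
  ... | no ¬ne = ≤-trans (≤-reflexive (trans (cong ∣_∣ (Empty-unique ¬ne)) (∣⊥∣≡0 n))) z≤n

  ¬Adj-refl : ∀ x → ¬ Adj G x x
  ¬Adj-refl x a with trans (≡.sym (irrfl G x)) a
  ... | ()

  Adj-sym : ∀ {x y} → Adj G x y → Adj G y x
  Adj-sym {x} {y} a = trans (Graph.sym G y x) a

  αLe-⊥ : αLe G ⊥ 0
  αLe-⊥ = αLe-nonempty λ S S⊆⊥ _ (x , x∈S) → ⊥-elim (∉⊥ (S⊆⊥ x∈S))

  αLe-∪ : ∀ {A B a b} → αLe G A a → αLe G B b → αLe G (A ∪ B) (a + b)
  αLe-∪ {A} {B} αA αB S S⊆A∪B ind = begin
    ∣ S ∣                   ≤⟨ p⊆q⇒∣p∣≤∣q∣ split ⟩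
    ∣ S ∩ A ∪ S ∩ B ∣       ≤⟨ ∣p∪q∣≤∣p∣+∣q∣ (S ∩ A) (S ∩ B) ⟩
    ∣ S ∩ A ∣ + ∣ S ∩ B ∣   ≤⟨ +-mono-≤ (part A αA) (part B αB) ⟩
    _                       ∎
    where
    open ≤-Reasoning
    split : S ⊆ S ∩ A ∪ S ∩ B
    split x∈S with x∈p∪q⁻ A B (S⊆A∪B x∈S)
    ... | inj₁ x∈A = x∈p∪q⁺ (inj₁ (x∈p∩q⁺ (x∈S , x∈A)))
    ... | inj₂ x∈B = x∈p∪q⁺ (inj₂ (x∈p∩q⁺ (x∈S , x∈B)))
    part : ∀ C {c} → αLe G C c → ∣ S ∩ C ∣ ≤ c
    part C αC = αC (S ∩ C) (p∩q⊆q S C) (Independent-⊆ (p∩q⊆p S C) ind)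

  αLe-⋃ : ∀ {k c} (A : Fin k → Subset n) → (∀ i → αLe G (A i) c) → αLe G (⋃ (List.tabulate A)) (k * c)
  αLe-⋃ {zero}  A αA = αLe-⊥
  αLe-⋃ {suc k} A αA = αLe-∪ (αA zero) (αLe-⋃ (A ∘ suc) (αA ∘ suc))

  LargeIndependent : ℕ → Subset n → Set
  LargeIndependent k A = Σ (Subset n) λ I → I ⊆ A × Independent G I × k ≤ ∣ I ∣

  largeIndependent? : ∀ k A → Dec (LargeIndependent k A)
  largeIndependent? k A = anySubset? λ I → (I ⊆? A) ×-dec (independent? I ×-dec (k ≤? ∣ I ∣))

  ¬LargeIndependent⇒αLe : ∀ {c A} → ¬ LargeIndependent (suc c) A → αLe G A c
  ¬LargeIndependent⇒αLe ¬large S S⊆A ind = ≮⇒≥ λ c<∣S∣ → ¬large (S , S⊆A , ind , c<∣S∣)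

  ¬LargeIndependent-⁅⁆ : ∀ {k} x → ¬ LargeIndependent (2 + k) ⁅ x ⁆
  ¬LargeIndependent-⁅⁆ x (I , I⊆⁅x⁆ , _ , 2+k≤∣I∣)
    with ≤-trans 2+k≤∣I∣ (≤-trans (p⊆q⇒∣p∣≤∣q∣ I⊆⁅x⁆) (≤-reflexive (∣⁅x⁆∣≡1 x)))
  ... | s≤s ()

  complete⇒HasInducedKtt : ∀ {t k A B} → t ≤ k → LargeIndependent k A → LargeIndependent k B →
    (∀ {x y} → x ∈ A → y ∈ B → Adj G x y) → HasInducedKtt G t
  complete⇒HasInducedKtt {t} t≤k (I , I⊆A , I-ind , k≤∣I∣) (J , J⊆B , J-ind , k≤∣J∣) complete
    with ≤∣p∣⇒injection t I (≤-trans t≤k k≤∣I∣) | ≤∣p∣⇒injection t J (≤-trans t≤k k≤∣J∣)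
  ... | f , f-inj , f∈I | g , g-inj , g∈J =
    f , g , f-inj , g-inj , f≢g , fg-adj ,
    (λ i j → I-ind (f i) (f j) (f∈I i) (f∈I j)) , (λ i j → J-ind (g i) (g j) (g∈J i) (g∈J j))
    where
    fg-adj : ∀ i j → Adj G (f i) (g j)
    fg-adj i j = complete (I⊆A (f∈I i)) (J⊆B (g∈J j))
    f≢g : ∀ i j → f i ≢ g j
    f≢g i j fi≡gj = ¬Adj-refl (g j) (subst (λ x → Adj G x (g j)) fi≡gj (fg-adj i j))

pairs-in-Fin3-meet : ∀ (i₀ j₀ i₁ j₁ : Fin 3) → i₀ ≢ j₀ → i₁ ≢ j₁ →
  (i₀ ≡ i₁ ⊎ i₀ ≡ j₁) ⊎ (j₀ ≡ i₁ ⊎ j₀ ≡ j₁)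
pairs-in-Fin3-meet = toWitness {a? = all? λ i₀ → all? λ j₀ → all? λ i₁ → all? λ j₁ →
  ¬? (i₀ ≟ᶠ j₀) →-dec (¬? (i₁ ≟ᶠ j₁) →-dec
    ((i₀ ≟ᶠ i₁ ⊎-dec i₀ ≟ᶠ j₁) ⊎-dec (j₀ ≟ᶠ i₁ ⊎-dec j₀ ≟ᶠ j₁)))} _

module Pattern {m : ℕ} (H : Graph m) where

  edge-≡ : ∀ {u v} {p p' : u < v} {q q' : Adj H u v} → edge {H = H} u v p q ≡ edge u v p' q'
  edge-≡ {p = p} {p'} {q} {q'} = cong₂ (edge _ _) (<-irrelevant p p') (uip q q')

  _≟ᴱ_ : (e f : Edge H) → Dec (e ≡ f)
  edge u v p q ≟ᴱ edge u' v' p' q' with u ≟ᶠ u' | v ≟ᶠ v'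
  ... | yes refl | yes refl = yes edge-≡
  ... | no u≢u'  | _        = no (u≢u' ∘ cong Edge.u)
  ... | yes _    | no v≢v'  = no (v≢v' ∘ cong Edge.v)

  any-edge? : {Q : Edge H → Set} → (∀ e → Dec (Q e)) → Dec (Σ (Edge H) Q)
  any-edge? {Q} Q? = map′ (λ (u , v , p , q , r) → edge u v p q , r)
                          (λ (edge u v p q , r) → u , v , p , q , r)
                          (any? λ u → any? λ v → Q-at? u v)
    where
    Q-at? : ∀ u v → Dec (Σ (u < v) λ p → Σ (Adj H u v) λ q → Q (edge u v p q))
    Q-at? u v with u <? v | adj H u v ≟ᴮ true
    ... | no u≮v | _       = no (u≮v ∘ proj₁)
    ... | yes _  | no ¬uv  = no (¬uv ∘ proj₁ ∘ proj₂)
    ... | yes p  | yes q   =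
      map′ (λ r → p , q , r) (λ (_ , _ , r) → subst Q edge-≡ r) (Q? (edge u v p q))

  Port : Set
  Port = Edge H × Bool

  end : Port → Fin m
  end (e , false) = Edge.u e
  end (e , true)  = Edge.v e

  flip : Port → Port
  flip (e , b) = e , not b

  any-port? : {Q : Port → Set} → (∀ P → Dec (Q P)) → Dec (Σ Port Q)
  any-port? {Q} Q? = map′ to from (any-edge? λ e → Q? (e , false) ⊎-dec Q? (e , true))
    where
    to : Σ (Edge H) (λ e → Q (e , false) ⊎ Q (e , true)) → Σ Port Q
    to (e , inj₁ r) = (e , false) , r
    to (e , inj₂ r) = (e , true) , r
    from : Σ Port Q → Σ (Edge H) (λ e → Q (e , false) ⊎ Q (e , true))
    from ((e , false) , r) = e , inj₁ r
    from ((e , true)  , r) = e , inj₂ r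

  ends-distinct : ∀ (e : Edge H) → Edge.u e ≢ Edge.v e
  ends-distinct e = <⇒≢ (Edge.u<v e)

  end-injective : ∀ (e : Edge H) {b b'} → end (e , b) ≡ end (e , b') → b ≡ b'
  end-injective e {false} {false} _  = refl
  end-injective e {true}  {true}  _  = refl
  end-injective e {false} {true}  eq = ⊥-elim (ends-distinct e eq)
  end-injective e {true}  {false} eq = ⊥-elim (ends-distinct e (≡.sym eq))

  port-≡ : ∀ {P P' : Port} → proj₁ P ≡ proj₁ P' → end P ≡ end P' → P ≡ P'
  port-≡ {e , b} refl eq = cong (e ,_) (end-injective e eq)

  corner : Triangle H → Fin 3 → Fin m
  corner D zero             = Triangle.a D
  corner D (suc zero)       = Triangle.b D
  corner D (suc (suc zero)) = Triangle.c D

  corner-index : ∀ {D : Triangle H} {w} → InTri D w → Σ (Fin 3) λ i → w ≡ corner D i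
  corner-index (inj₁ w≡a)        = zero , w≡a
  corner-index (inj₂ (inj₁ w≡b)) = suc zero , w≡b
  corner-index (inj₂ (inj₂ w≡c)) = suc (suc zero) , w≡c

  EdgeOf : Triangle H → Edge H → Set
  EdgeOf D e = InTri D (Edge.u e) × InTri D (Edge.v e)

  edges-of-triangle-meet : ∀ {D : Triangle H} {e f} → EdgeOf D e → EdgeOf D f →
    Σ Bool λ b → Σ Bool λ b' → end (e , b) ≡ end (f , b')
  edges-of-triangle-meet {D} {e} {f} (eu , ev) (fu , fv)
    with corner-index {D = D} eu | corner-index {D = D} ev
       | corner-index {D = D} fu | corner-index {D = D} fv
  ... | i₀ , e-u | j₀ , e-v | i₁ , f-u | j₁ , f-v
    with pairs-in-Fin3-meet i₀ j₀ i₁ j₁ (λ { refl → ends-distinct e (trans e-u (≡.sym e-v)) })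
                                         (λ { refl → ends-distinct f (trans f-u (≡.sym f-v)) })
  ... | inj₁ (inj₁ refl) = false , false , trans e-u (≡.sym f-u)
  ... | inj₁ (inj₂ refl) = false , true  , trans e-u (≡.sym f-v)
  ... | inj₂ (inj₁ refl) = true  , false , trans e-v (≡.sym f-u)
  ... | inj₂ (inj₂ refl) = true  , true  , trans e-v (≡.sym f-v)

module Strips {n m : ℕ} {G : Graph n} {Z : Subset n} {H : Graph m} (E : ESD G Z H) where
  open ESD E
  open Pattern H

  endOf : ∀ P → EndOf (proj₁ P) (end P)
  endOf (e , false) = lft
  endOf (e , true)  = rgt

  ηᴾ : Port → Subset n
  ηᴾ P = η₂ (proj₁ P) (end P) (endOf P)

  ηᴾ⊆η : ∀ P → ηᴾ P ⊆ η (inE (proj₁ P))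
  ηᴾ⊆η P = end⊆ (proj₁ P) (end P) (endOf P)

  portOf : ∀ {e w} (p : EndOf e w) → Σ Bool λ b → end (e , b) ≡ w × ηᴾ (e , b) ≡ η₂ e w p
  portOf lft = false , refl , refl
  portOf rgt = true  , refl , refl

  ∈-port : ∀ {e w} (p : EndOf e w) {x} → x ∈ η₂ e w p → Σ Bool λ b → end (e , b) ≡ w × x ∈ ηᴾ (e , b)
  ∈-port lft x∈ = false , refl , x∈
  ∈-port rgt x∈ = true  , refl , x∈

  ∈-both-ports : ∀ {e x} → x ∈ η₂ e (Edge.u e) lft → x ∈ η₂ e (Edge.v e) rgt → ∀ b → x ∈ ηᴾ (e , b)
  ∈-both-ports x∈u _   false = x∈u
  ∈-both-ports _   x∈v true  = x∈v

  η₂-at : ∀ {e w w'} → w ≡ w' → (p : EndOf e w) → Σ (EndOf e w') λ p' → η₂ e w p ⊆ η₂ e w' p'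
  η₂-at refl p = p , λ x∈ → x∈

  ports-at-same-end : ∀ P P' → end P ≡ end P' →
    P ≡ P' ⊎ (∀ {x y} → x ∈ ηᴾ P → y ∈ ηᴾ P' → Adj G x y)
  ports-at-same-end P P' same with proj₁ P ≟ᴱ proj₁ P' | η₂-at (≡.sym same) (endOf P')
  ... | yes e≡e' | _ = inj₁ (port-≡ e≡e' same)
  ... | no e≢e'  | q , P'⊆q = inj₂ λ x∈ y∈ →
    Equivalence.from (edges _ _ e≢e' _ _ (ηᴾ⊆η P x∈) (ηᴾ⊆η P' y∈)) (end P , endOf P , q , x∈ , P'⊆q y∈)

  independent⊆port : ∀ {S s P₀ x₀} → Independent G S →
    (∀ {y} → y ∈ S → Σ Port λ P → end P ≡ s × y ∈ ηᴾ P) → x₀ ∈ S → x₀ ∈ ηᴾ P₀ → end P₀ ≡ s → S ⊆ ηᴾ P₀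
  independent⊆port {P₀ = P₀} ind at-s x₀∈S x₀∈P₀ P₀-at y∈S with at-s y∈S
  ... | P , P-at , y∈P with ports-at-same-end P₀ P (trans P₀-at (≡.sym P-at))
  ...   | inj₁ refl     = y∈P
  ...   | inj₂ complete = ⊥-elim (ind _ _ x₀∈S y∈S (complete x₀∈P₀ y∈P))

module LargePorts {n m : ℕ} {G : Graph n} {Z : Subset n} {H : Graph m} (E : ESD G Z H)
                  {t : ℕ} (Ktt-free : KttFree G t) where
  open Pattern H
  open Strips E

  -- The threshold 2 + t rather than t also makes the singleton port class of a leaf small.
  Large : Port → Set
  Large P = LargeIndependent {G = G} (2 + t) (ηᴾ P)

  Large? : ∀ P → Dec (Large P)
  Large? P = largeIndependent? {G = G} (2 + t) (ηᴾ P)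

  large-port-unique : ∀ P P' → Large P → Large P' → end P ≡ end P' → P ≡ P'
  large-port-unique P P' large large' same with ports-at-same-end P P' same
  ... | inj₁ P≡P'     = P≡P'
  ... | inj₂ complete =
    ⊥-elim (Ktt-free (complete⇒HasInducedKtt {G = G} (m≤n+m t 2) large large' complete))

  SmallAt : Fin m → Fin n → Set
  SmallAt s y = Σ Port λ P → end P ≡ s × y ∈ ηᴾ P × ¬ Large P

  SmallAt? : ∀ s y → Dec (SmallAt s y)
  SmallAt? s y = any-port? λ P → (end P ≟ᶠ s) ×-dec ((y ∈? ηᴾ P) ×-dec ¬? (Large? P))

  smallAt : Fin m → Subset n
  smallAt s = toSubset (SmallAt? s)

  SmallBeyond : Fin m → Fin n → Set
  SmallBeyond s y = Σ Port λ P → end P ≡ s × Large P × SmallAt (end (flip P)) y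

  SmallBeyond? : ∀ s y → Dec (SmallBeyond s y)
  SmallBeyond? s y = any-port? λ P → (end P ≟ᶠ s) ×-dec (Large? P ×-dec SmallAt? (end (flip P)) y)

  smallBeyond : Fin m → Subset n
  smallBeyond s = toSubset (SmallBeyond? s)

  αLe-smallAt : ∀ s → αLe G (smallAt s) (suc t)
  αLe-smallAt s = αLe-nonempty {G = G} bound
    where
    bound : ∀ S → S ⊆ smallAt s → Independent G S → Nonempty S → ∣ S ∣ ≤ suc t
    bound S S⊆ ind (x₀ , x₀∈S) with ∈-toSubset⁻ (SmallAt? s) (S⊆ x₀∈S)
    ... | P₀ , P₀-at , x₀∈P₀ , P₀-small =
      ¬LargeIndependent⇒αLe {G = G} P₀-small S (independent⊆port {P₀ = P₀} ind at-s x₀∈S x₀∈P₀ P₀-at) ind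
      where
      at-s : ∀ {y} → y ∈ S → Σ Port λ P → end P ≡ s × y ∈ ηᴾ P
      at-s y∈S with ∈-toSubset⁻ (SmallAt? s) (S⊆ y∈S)
      ... | P , P-at , y∈P , _ = P , P-at , y∈P

  αLe-smallBeyond : ∀ s → αLe G (smallBeyond s) (suc t)
  αLe-smallBeyond s = αLe-nonempty {G = G} bound
    where
    bound : ∀ S → S ⊆ smallBeyond s → Independent G S → Nonempty S → ∣ S ∣ ≤ suc t
    bound S S⊆ ind (x₀ , x₀∈S) with ∈-toSubset⁻ (SmallBeyond? s) (S⊆ x₀∈S)
    ... | P₀ , P₀-at , P₀-large , _ = αLe-smallAt (end (flip P₀)) S beyond ind
      where
      beyond : S ⊆ smallAt (end (flip P₀))
      beyond y∈S with ∈-toSubset⁻ (SmallBeyond? s) (S⊆ y∈S)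
      ... | P , P-at , P-large , y-small
        with large-port-unique P P₀ P-large P₀-large (trans P-at (≡.sym P₀-at))
      ...   | refl = ∈-toSubset⁺ (SmallAt? _) y-small

LeafCut : ∀ {n} → Graph n → Subset n → Fin n → ℕ → Set
LeafCut {n} G Z v c = Σ (Subset n) λ X → v ∉ X × (∀ (P : LeafPath G Z v) → Meets X P) × αLe G X c

-- T₀ lists, with repetitions, the vertices of H incident with the location of v.
module Region {n m : ℕ} {G : Graph n} {Z : Subset n} {H : Graph m} (E : ESD G Z H)
              {t : ℕ} (Ktt-free : KttFree G t) (v : Fin n) (T₀ : Fin 3 → Fin m)
              (T₀-covers : ∀ e b → v ∈ ESD.η E (inE e) → Σ (Fin 3) λ i → Pattern.end H (e , b) ≡ T₀ i)
              where
  open ESD E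
  open Pattern H
  open Strips E
  open LargePorts E Ktt-free

  guard : Fin 3 → Subset n
  guard i = smallAt (T₀ i) ∪ smallBeyond (T₀ i)

  -- Without abstract, unification unfolds U and X into every decision procedure above,
  -- which makes type checking of this module impractically slow.
  abstract
    U : Subset n
    U = ⋃ (List.tabulate guard)

    ∈U⁺ : ∀ i {y} → y ∈ guard i → y ∈ U
    ∈U⁺ = ∈-⋃⁺ guard

    αLe-U : αLe G U (3 * (suc t + suc t))
    αLe-U = αLe-⋃ {G = G} guard λ i → αLe-∪ {G = G} (αLe-smallAt (T₀ i)) (αLe-smallBeyond (T₀ i))

    X? : ∀ y → Dec (y ∈ U × y ≢ v)
    X? y = (y ∈? U) ×-dec ¬? (y ≟ᶠ v)

    X : Subset n
    X = toSubset X?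

    X⊆U : X ⊆ U
    X⊆U x∈X = proj₁ (∈-toSubset⁻ X? x∈X)

    v∉X : v ∉ X
    v∉X v∈X = proj₂ (∈-toSubset⁻ X? v∈X) refl

    ∉X⇒∉U : ∀ {x} → x ∉ X → x ≢ v → x ∉ U
    ∉X⇒∉U x∉X x≢v x∈U = x∉X (∈-toSubset⁺ X? (x∈U , x≢v))

  αLe-X : αLe G X (3 * (suc t + suc t))
  αLe-X = αLe-⊆ {G = G} X⊆U αLe-U

  Watched : Fin m → Set
  Watched s = (Σ (Fin 3) λ i → s ≡ T₀ i) ⊎
              (Σ (Fin 3) λ i → Σ Port λ P → end P ≡ T₀ i × Large P × s ≡ end (flip P))

  watched-small⇒∈U : ∀ {s y} → Watched s → SmallAt s y → y ∈ U
  watched-small⇒∈U (inj₁ (i , refl)) small =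
    ∈U⁺ i (x∈p∪q⁺ {p = smallAt (T₀ i)} (inj₁ (∈-toSubset⁺ (SmallAt? (T₀ i)) small)))
  watched-small⇒∈U (inj₂ (i , P , at , large , refl)) small =
    ∈U⁺ i (x∈p∪q⁺ {p = smallAt (T₀ i)}
             (inj₂ (∈-toSubset⁺ (SmallBeyond? (T₀ i)) (P , at , large , small))))

  watched-large : ∀ {s y} P → Watched s → y ∉ U → y ∈ ηᴾ P → end P ≡ s → Large P
  watched-large P w y∉U y∈P at =
    decidable-stable (Large? P) λ small → y∉U (watched-small⇒∈U w (P , at , y∈P , small))

  Inner : Edge H → Set
  Inner e = (Σ (Fin 3) λ i → Σ Bool λ b → end (e , b) ≡ T₀ i × Large (e , b)) ⊎ v ∈ η (inE e)

  inner-watched : ∀ {e} → Inner e → ∀ b → Watched (end (e , b))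
  inner-watched     (inj₁ (i , false , at , _))     false = inj₁ (i , at)
  inner-watched     (inj₁ (i , true  , at , _))     true  = inj₁ (i , at)
  inner-watched {e} (inj₁ (i , false , at , large)) true  = inj₂ (i , (e , false) , at , large , refl)
  inner-watched {e} (inj₁ (i , true  , at , large)) false = inj₂ (i , (e , true)  , at , large , refl)
  inner-watched     (inj₂ v∈e)                      b     = inj₁ (T₀-covers _ b v∈e)

  LargeInner : Fin m → Set
  LargeInner s = ∀ P → end P ≡ s → Large P → Inner (proj₁ P)

  Guarded : Fin m → Set
  Guarded s = Watched s × LargeInner s

  T₀-guarded : ∀ i → Guarded (T₀ i)
  T₀-guarded i = inj₁ (i , refl) , λ (e , b) at large → inj₁ (i , b , at , large)

  guarded-exit : ∀ {s y} P → Guarded s → y ∉ U → y ∈ ηᴾ P → end P ≡ s → Inner (proj₁ P)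
  guarded-exit P (watched , large-inner) y∉U y∈P at =
    large-inner P at (watched-large P watched y∉U y∈P at)

  Open : Port → Set
  Open P = Large P ⊎ v ∈ ηᴾ P

  inner-open : ∀ {e b x} → Inner e → x ∉ X → x ∈ ηᴾ (e , b) → Open (e , b)
  inner-open {e} {b} {x} inner x∉X x∈P with x ≟ᶠ v
  ... | yes refl = inj₂ x∈P
  ... | no x≢v   = inj₁ (watched-large (e , b) (inner-watched inner b) (∉X⇒∉U x∉X x≢v) x∈P refl)

  inner-guarded : ∀ {e b x} → Inner e → x ∉ X → x ∈ ηᴾ (e , b) → Guarded (end (e , b))
  inner-guarded {e} {b} inner x∉X x∈P = inner-watched inner b , large-inner (inner-open inner x∉X x∈P)
    where
    large-inner : Open (e , b) → LargeInner (end (e , b))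
    large-inner (inj₁ large) P at large' =
      subst (Inner ∘ proj₁) (large-port-unique (e , b) P large large' (≡.sym at)) inner
    large-inner (inj₂ v∈P) (_ , b') at large' with T₀-covers e b (ηᴾ⊆η (e , b) v∈P)
    ... | i , e-at = inj₁ (i , b' , trans at e-at , large')

  Inside : Loc H → Set
  Inside (inE e) = Inner e
  Inside (inV s) = Guarded s
  Inside (inT D) = Σ (Edge H) λ e → EdgeOf D e × ∀ b → Guarded (end (e , b))

  Reached : Fin n → Set
  Reached x = Σ (Loc H) λ L → x ∈ η L × Inside L × x ∉ X

  x∉η-other : ∀ {x} L L' → x ∈ η L → L ≢ L' → x ∉ η L'
  x∉η-other L L' x∈L L≢L' x∈L' = L≢L' (unique L L' _ x∈L x∈L')

  leave-vertex : ∀ {s x y} → x ∈ η (inV s) → Guarded s → Adj G x y → y ∉ U → y ∉ η (inV s) →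
    Σ (Loc H) λ L → y ∈ η L × Inside L
  leave-vertex {s} x∈s guarded a y∉U y∉s with vertex s _ _ x∈s y∉s a
  ... | e , p , y∈p with ∈-port p y∈p
  ...   | b , at , y∈P = inE e , ηᴾ⊆η (e , b) y∈P , guarded-exit (e , b) guarded y∉U y∈P at

  leave-triangle : ∀ {D x y} → x ∈ η (inT D) → Inside (inT D) → Adj G x y → y ∉ U → y ∉ η (inT D) →
    Σ (Loc H) λ L → y ∈ η L × Inside L
  leave-triangle {D} x∈D (e₀ , e₀∈D , guarded) a y∉U y∉D with tri D _ _ x∈D y∉D a
  ... | e , eu , ev , y∈u , y∈v with edges-of-triangle-meet {D = D} (eu , ev) e₀∈D
  ...   | b , b₀ , meet =
    inE e , end⊆ e _ lft y∈u , guarded-exit (e , b) (guarded b₀) y∉U (∈-both-ports y∈u y∈v b) meet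

  leave-edge : ∀ {e x y} → x ∈ η (inE e) → Inner e → x ∉ X → Adj G x y → y ∉ U → y ∉ η (inE e) →
    Σ (Loc H) λ L → y ∈ η L × Inside L
  leave-edge {e} {x} {y} x∈e inner x∉X a y∉U y∉e with cover y
  ... | inE e' , y∈e' with Equivalence.to (edges e e' (λ { refl → y∉e y∈e' }) x y x∈e y∈e') a
  ...   | _ , p , q , x∈p , y∈q with ∈-port p x∈p | ∈-port q y∈q
  ...     | b , at , x∈P | b' , at' , y∈P' =
    inE e' , y∈e' , guarded-exit (e' , b') (inner-guarded inner x∉X x∈P) y∉U y∈P' (trans at' (≡.sym at))
  leave-edge {e} {x} {y} x∈e inner x∉X a y∉U y∉e | inV s , y∈s
    with vertex s y x y∈s (x∉η-other (inE e) (inV s) x∈e λ ()) (Adj-sym {G = G} a)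
  ... | e' , p , x∈p with unique (inE e') (inE e) x (end⊆ e' s p x∈p) x∈e | ∈-port p x∈p
  ...   | refl | b , at , x∈P = inV s , y∈s , subst Guarded at (inner-guarded inner x∉X x∈P)
  leave-edge {e} {x} {y} x∈e inner x∉X a y∉U y∉e | inT D , y∈D
    with tri D y x y∈D (x∉η-other (inE e) (inT D) x∈e λ ()) (Adj-sym {G = G} a)
  ... | e' , eu , ev , x∈u , x∈v with unique (inE e') (inE e) x (end⊆ e' _ lft x∈u) x∈e
  ...   | refl = inT D , y∈D , e , (eu , ev) , λ b → inner-guarded inner x∉X (∈-both-ports x∈u x∈v b)

  inside-closed : ∀ {x y} → Reached x → Adj G x y → y ∉ U → Σ (Loc H) λ L → y ∈ η L × Inside L
  inside-closed {y = y} (L , x∈L , ins , x∉X) a y∉U with y ∈? η L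
  ... | yes y∈L = L , y∈L , ins
  ... | no  y∉L with L
  ...   | inE e = leave-edge x∈L ins x∉X a y∉U y∉L
  ...   | inV s = leave-vertex x∈L ins a y∉U y∉L
  ...   | inT D = leave-triangle x∈L ins a y∉U y∉L

  reached-closed : Reached v → ∀ {x y} → Reached x → Adj G x y → y ∉ X → Reached y
  reached-closed reached-v {y = y} reached-x a y∉X with y ≟ᶠ v
  ... | yes refl = reached-v
  ... | no  y≢v  = let (L , y∈L , ins) = inside-closed reached-x a (∉X⇒∉U y∉X y≢v) in L , y∈L , ins , y∉X

  leaf-unreached : v ∉ Z → ∀ {z} → z ∈ Z → ¬ Reached z
  leaf-unreached v∉Z {z} z∈Z (L , z∈L , ins , z∉X) with leaves z z∈Z
  ... | _ , _ , e , p , η₂≡⁅z⁆ with portOf p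
  ...   | b , _ , P≡η₂ = ∉X⇒∉U z∉X (λ { refl → v∉Z z∈Z }) z∈U
    where
    P≡⁅z⁆ : ηᴾ (e , b) ≡ ⁅ z ⁆
    P≡⁅z⁆ = trans P≡η₂ η₂≡⁅z⁆
    z∈P : z ∈ ηᴾ (e , b)
    z∈P = subst (z ∈_) (≡.sym P≡⁅z⁆) (x∈⁅x⁆ z)
    inner : Inner e
    inner = subst Inside (unique L (inE e) z z∈L (ηᴾ⊆η (e , b) z∈P)) ins
    small : ¬ Large (e , b)
    small large = ¬LargeIndependent-⁅⁆ {G = G} z (subst (LargeIndependent {G = G} (2 + t)) P≡⁅z⁆ large)
    z∈U : z ∈ U
    z∈U = watched-small⇒∈U (inner-watched inner b) ((e , b) , refl , z∈P , small)

  leafPath-meets-X : v ∉ Z → Reached v → (P : LeafPath G Z v) → Meets X P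
  leafPath-meets-X v∉Z reached-v P =
    fromInj₂ (⊥-elim ∘ leaf-unreached v∉Z start)
             (propagate-down (Reached ∘ path) step (subst Reached (≡.sym stop) reached-v))
    where
    open LeafPath P
    step : ∀ j → Reached (path (suc j)) → Reached (path (inject₁ j)) ⊎ Meets X P
    step j reached with path (inject₁ j) ∈? X
    ... | yes p∈X = inj₂ (inject₁ j , p∈X)
    ... | no  p∉X = inj₁ (reached-closed reached-v reached (IsInducedPath-adjacent {G = G} isInd j) p∉X)

  leaf-cut : v ∉ Z → Reached v → LeafCut G Z v (3 * (suc t + suc t))
  leaf-cut v∉Z reached-v = X , v∉X , leafPath-meets-X v∉Z reached-v , αLe-X

module _ {n m : ℕ} {G : Graph n} {Z : Subset n} {H : Graph m} (E : ESD G Z H)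
         {t : ℕ} (Ktt-free : KttFree G t) (v : Fin n) (v∉Z : v ∉ Z) where
  open ESD E
  open Pattern H

  leaf-cut-in-edge : ∀ e → v ∈ η (inE e) → LeafCut G Z v (3 * (suc t + suc t))
  leaf-cut-in-edge e v∈e = leaf-cut v∉Z (inE e , v∈e , inj₂ v∈e , v∉X)
    where
    T₀ : Fin 3 → Fin m
    T₀ = lookup (Edge.u e ∷ Edge.v e ∷ Edge.u e ∷ [])
    covers : ∀ e' b → v ∈ η (inE e') → Σ (Fin 3) λ i → end (e' , b) ≡ T₀ i
    covers e' b v∈e' with unique (inE e') (inE e) v v∈e' v∈e | b
    ... | refl | false = zero , refl
    ... | refl | true  = suc zero , refl
    open Region E Ktt-free v T₀ covers

  leaf-cut-in-vertex : ∀ a → v ∈ η (inV a) → LeafCut G Z v (3 * (suc t + suc t))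
  leaf-cut-in-vertex a v∈a = leaf-cut v∉Z (inV a , v∈a , T₀-guarded zero , v∉X)
    where
    covers : ∀ e b → v ∈ η (inE e) → Σ (Fin 3) λ i → end (e , b) ≡ a
    covers e b v∈e with unique (inE e) (inV a) v v∈e v∈a
    ... | ()
    open Region E Ktt-free v (λ _ → a) covers

  leaf-cut-in-triangle : ∀ D → v ∈ η (inT D) → LeafCut G Z v (3 * (suc t + suc t))
  leaf-cut-in-triangle D v∈D =
    leaf-cut v∉Z (inT D , v∈D , (ab , (inj₁ refl , inj₂ (inj₁ refl)) , guarded) , v∉X)
    where
    covers : ∀ e b → v ∈ η (inE e) → Σ (Fin 3) λ i → end (e , b) ≡ corner D i
    covers e b v∈e with unique (inE e) (inT D) v v∈e v∈D
    ... | ()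
    open Region E Ktt-free v (corner D) covers
    ab : Edge H
    ab = edge (Triangle.a D) (Triangle.b D) (Triangle.a<b D) (Triangle.ab D)
    guarded : ∀ s → Guarded (end (ab , s))
    guarded false = T₀-guarded zero
    guarded true  = T₀-guarded (suc zero)

  leaf-cut-exists : LeafCut G Z v (3 * (suc t + suc t))
  leaf-cut-exists with cover v
  ... | inE e , v∈e = leaf-cut-in-edge e v∈e
  ... | inV a , v∈a = leaf-cut-in-vertex a v∈a
  ... | inT D , v∈D = leaf-cut-in-triangle D v∈D

theorem4p1 : (t : ℕ) → Σ ℕ λ c →
    ∀ {n m : ℕ} (G : Graph n) (Z : Subset n) (H : Graph m) (η : ESD G Z H) →
    KttFree G t → 2 ≤ ∣ Z ∣ →
    ∀ (v : Fin n) → v ∉ Z →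
    Σ (Subset n) λ X → v ∉ X ×
      (∀ (P : LeafPath G Z v) → Meets X P) ×
      αLe G X c
theorem4p1 t = 3 * (suc t + suc t) , λ G Z H E Ktt-free _ v v∉Z → leaf-cut-exists E Ktt-free v v∉Z
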